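{- Let $G$ be any graph and let $k,t\in\mathbb{N}$. If $t \geq \left(P_{DP}(G,\chi_{DP}(G)+k-1)\right)^{k}$, then $\chi_{DP}(G\square K_{k,t}) = \chi_{DP}(G) + k$.
   Context: All graphs are finite, simple and nonempty. $K_{k,t}$ is the complete bipartite graph with parts of sizes $k$ and $t$. $G\square H$ is the Cartesian product: vertex set $V(G)\times V(H)$, with $(u,v)\sim(u',v')$ iff either $u=u'$ and $vv'\in E(H)$, or $v=v'$ and $uu'\in E(G)$. A cover of a graph $G$ is a pair $\mathcal{H}=(L,H)$ where $H$ is a graph and $L:V(G)\to\mathcal{P}(V(H))$ such that: (1) $\{L(v):v\in V(G)\}$ partitions $V(H)$ into $|V(G)|$ parts; (2) each $H[L(v)]$ is complete; (3) if there is an edge of $H$ between $L(u)$ and $L(v)$ then $u=v$ or $uv\in E(G)$; (4) if $uv\in E(G)$ the edges of $H$ between $L(u)$ and $L(v)$ form a (possibly empty) matching. It is $m$-fold if $|L(v)|=m$ for all $v$. An $\mathcal{H}$-coloring of $G$ is an independent set of $H$ of size $|V(G)|$. $\chi_{DP}(G)$ is the least $m$ such that $G$ admits an $\mathcal{H}$-coloring for every $m$-fold cover $\mathcal{H}$. For a cover $\mathcal{H}$, $P_{DP}(G,\mathcal{H})$ is the number of $\mathcal{H}$-colorings of $G$, and the DP color function $P_{DP}(G,m)$ is the minimum of $P_{DP}(G,\mathcal{H})$ over all $m$-fold covers $\mathcal{H}$ of $G$. -}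

module Defs where

open import Data.Nat using (ℕ; zero; suc; _+_; _*_; _<ᵇ_)
open import Data.Bool using (Bool; true; false; _∧_; _∨_; not; _xor_; if_then_else_)
open import Data.Fin using (Fin; toℕ; remQuot; _≟_)
open import Data.Fin.Subset using (∣_∣)
open import Data.Vec using (Vec; []; _∷_; lookup; toList)
open import Data.List using (List; []; _∷_; map; concatMap; filter; length; allFin)
open import Data.Nat.ListAction using (sum)
open import Data.Bool.ListAction using (all)
open import Data.Product using (_×_; _,_; proj₁; proj₂; Σ)
open import Data.Sum using (_⊎_)
open import Relation.Nullary using (¬_; yes; no)
open import Relation.Nullary.Decidable using (⌊_⌋)
open import Relation.Binary.PropositionalEquality using (_≡_; refl; sym; cong₂)

record Graph : Set where
  field
    n      : ℕ
    adj    : Fin n → Fin n → Bool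
    adj-sym   : ∀ u v → adj u v ≡ adj v u
    adj-irrefl : ∀ v → adj v v ≡ false
open Graph public

_==_ : ∀ {m} → Fin m → Fin m → Bool
a == b = ⌊ a ≟ b ⌋

==-refl : ∀ {m} (a : Fin m) → (a == a) ≡ true
==-refl a with a ≟ a
... | yes _ = refl
... | no ¬p = Data.Empty.⊥-elim (¬p refl)
  where import Data.Empty

==-sym : ∀ {m} (a b : Fin m) → (a == b) ≡ (b == a)
==-sym a b with a ≟ b | b ≟ a
... | yes _ | yes _ = refl
... | no _  | no _  = refl
... | yes p | no ¬q = Data.Empty.⊥-elim (¬q (sym p))
  where import Data.Empty
... | no ¬p | yes q = Data.Empty.⊥-elim (¬p (sym q))
  where import Data.Empty

∨-false : ∀ {a b : Bool} → a ≡ false → b ≡ false → (a ∨ b) ≡ false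
∨-false refl refl = refl

∧-false : ∀ (a : Bool) {b : Bool} → b ≡ false → (a ∧ b) ≡ false
∧-false true refl = refl
∧-false false refl = refl

-- Cartesian product G □ H.  Vertex (u , v) is encoded as the element x
-- of Fin (n G * n H) with remQuot (n H) x ≡ (u , v)  (inverse: combine).

π₁ : (G H : Graph) → Fin (n G * n H) → Fin (n G)
π₁ G H x = proj₁ (remQuot {n G} (n H) x)

π₂ : (G H : Graph) → Fin (n G * n H) → Fin (n H)
π₂ G H x = proj₂ (remQuot {n G} (n H) x)

□-adj : (G H : Graph) → Fin (n G * n H) → Fin (n G * n H) → Bool
□-adj G H x y =
    ((π₁ G H x == π₁ G H y) ∧ adj H (π₂ G H x) (π₂ G H y))
  ∨ ((π₂ G H x == π₂ G H y) ∧ adj G (π₁ G H x) (π₁ G H y))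

_□_ : Graph → Graph → Graph
G □ H = record
  { n = n G * n H
  ; adj = □-adj G H
  ; adj-sym = sy
  ; adj-irrefl = irr
  }
  where
  sy : ∀ x y → □-adj G H x y ≡ □-adj G H y x
  sy x y =
    cong₂ _∨_ (cong₂ _∧_ (==-sym (π₁ G H x) (π₁ G H y)) (adj-sym H (π₂ G H x) (π₂ G H y)))
              (cong₂ _∧_ (==-sym (π₂ G H x) (π₂ G H y)) (adj-sym G (π₁ G H x) (π₁ G H y)))
  irr : ∀ x → □-adj G H x x ≡ false
  irr x = ∨-false (∧-false (π₁ G H x == π₁ G H x) (adj-irrefl H (π₂ G H x)))
                  (∧-false (π₂ G H x == π₂ G H x) (adj-irrefl G (π₁ G H x)))

-- Complete bipartite graph K_{k,t}: vertex set Fin (k + t); the vertices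
-- with index < k form the part of size k, the rest the part of size t.

xor-self : ∀ b → (b xor b) ≡ false
xor-self true = refl
xor-self false = refl

xor-comm : ∀ a b → (a xor b) ≡ (b xor a)
xor-comm true true = refl
xor-comm true false = refl
xor-comm false true = refl
xor-comm false false = refl

K : ℕ → ℕ → Graph
K k t = record
  { n = k + t
  ; adj = λ x y → (toℕ x <ᵇ k) xor (toℕ y <ᵇ k)
  ; adj-sym = λ x y → xor-comm (toℕ x <ᵇ k) (toℕ y <ᵇ k)
  ; adj-irrefl = λ x → xor-self (toℕ x <ᵇ k)
  }

-- m-fold covers.  Condition (1) is built in: V(H) = V(G) × Fin m and
-- L(v) = {v} × Fin m.  hadj u i v j is adjacency in H of (u,i) and (v,j).

record Cover (G : Graph) (m : ℕ) : Set where
  field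
    hadj : Fin (n G) → Fin m → Fin (n G) → Fin m → Bool
    hadj-sym    : ∀ u i v j → hadj u i v j ≡ hadj v j u i
    hadj-irrefl : ∀ v i → hadj v i v i ≡ false
    clique : ∀ v i j → ¬ (i ≡ j) → hadj v i v j ≡ true
    respects : ∀ u i v j → hadj u i v j ≡ true → (u ≡ v) ⊎ (adj G u v ≡ true)
    matchingˡ : ∀ u v → adj G u v ≡ true → ∀ i j j' →
                hadj u i v j ≡ true → hadj u i v j' ≡ true → j ≡ j'
    matchingʳ : ∀ u v → adj G u v ≡ true → ∀ i i' j →
                hadj u i v j ≡ true → hadj u i' v j ≡ true → i ≡ i'
open Cover public

-- Subsets of V(H) = Fin (n G) × Fin m, as Boolean matrices.

VSubset : ℕ → ℕ → Set
VSubset a m = Vec (Vec Bool m) a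

mem : ∀ {a m} → VSubset a m → Fin a → Fin m → Bool
mem S v i = lookup (lookup S v) i

size : ∀ {a m} → VSubset a m → ℕ
size S = sum (Data.List.map ∣_∣ (toList S))
  where import Data.List

allVecs : ∀ {A : Set} → List A → (k : ℕ) → List (Vec A k)
allVecs xs zero = [] ∷ []
allVecs xs (suc k) = concatMap (λ x → map (x ∷_) (allVecs xs k)) xs

allVSubsets : (a m : ℕ) → List (VSubset a m)
allVSubsets a m = allVecs (allVecs (true ∷ false ∷ []) m) a

isIndependent : ∀ {G m} → Cover G m → VSubset (n G) m → Bool
isIndependent {G} {m} 𝓗 S =
  all (λ u → all (λ i → all (λ v → all (λ j →
    not (mem S u i ∧ mem S v j ∧ hadj 𝓗 u i v j))
    (allFin m)) (allFin (n G))) (allFin m)) (allFin (n G))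

isColoring : ∀ {G m} → Cover G m → VSubset (n G) m → Bool
isColoring {G} 𝓗 S = isIndependent 𝓗 S ∧ (size S Data.Nat.≡ᵇ n G)
  where import Data.Nat

HasColoring : ∀ {G m} → Cover G m → Set
HasColoring {G} {m} 𝓗 = Σ (VSubset (n G) m) (λ S → isColoring 𝓗 S ≡ true)

P-DP-cover : ∀ {G m} → Cover G m → ℕ
P-DP-cover {G} {m} 𝓗 =
  length (filter (λ S → isColoring 𝓗 S Data.Bool.≟ true) (allVSubsets (n G) m))
  where import Data.Bool

DPColorable : Graph → ℕ → Set
DPColorable G m = (𝓗 : Cover G m) → HasColoring 𝓗

IsChiDP : Graph → ℕ → Set
IsChiDP G c = DPColorable G c × (∀ m → m Data.Nat.< c → ¬ DPColorable G m)
  where import Data.Nat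

IsPDP : Graph → ℕ → ℕ → Set
IsPDP G m p = Σ (Cover G m) (λ 𝓗 → P-DP-cover 𝓗 ≡ p)
            × ((𝓗 : Cover G m) → p Data.Nat.≤ P-DP-cover 𝓗)
  where import Data.Nat

-- Let c = χ_DP(G), and let A and B be the sides of K_{k,t} of sizes k and t.  For the upper bound,
-- color every layer G × {a}, a ∈ A, from the first c colors of its lists.  A vertex (u, b), b ∈ B,
-- has only the k neighbours (u, a) outside its own layer, and through the matchings each of them
-- blocks at most one of its c + k colors; the c colors left at each vertex form a c-fold cover of
-- the layer G × {b}.
-- For the lower bound, fix a (c+k-1)-fold cover 𝓗₀ of G with the minimum number p of colorings.
-- As t ≥ p^k, B can be indexed by all k-tuples of 𝓗₀-colorings.  Put 𝓗₀ on every layer G × {a}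
-- and an arbitrary (c-1)-fold cover 𝓑 of G, plus k reserved colors, on every G × {b}, matching
-- the a-th reserved color at (u, b) with the color of u in the a-th coloring of the tuple b.
-- A coloring of this cover restricts to an 𝓗₀-coloring on each G × {a}, so on the layer of that
-- tuple no reserved color is usable and 𝓑 gets colored; hence G □ K_{k,t} is not DP-(c+k-1)-colorable.

module Submission where

open import Defs
open import Data.Nat using (ℕ; zero; suc; _+_; _∸_; _^_; _≤_; _<_; _<ᵇ_; z≤n; s≤s)
  renaming (_<?_ to _<ℕ?_)
open import Data.Nat.Properties using (≤-trans; ≤-reflexive; <-irrefl; +-comm; +-mono-≤; +-monoˡ-≤; n<1+n;
  m+n≮m; m≤n⇒m<n∨m≡n; <⇒<ᵇ; <ᵇ⇒<; ≡⇒≡ᵇ; ≡ᵇ⇒≡)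
open import Data.Bool using (Bool; true; false; _∧_; _∨_; _xor_; not; if_then_else_)
import Data.Bool as Bool
open import Data.Bool.Properties using (T-≡; ¬-not)
open import Data.Bool.ListAction using (all)
open import Data.Fin using (Fin; zero; suc; toℕ; fromℕ<; inject₁; inject≤; combine;
  _↑ˡ_; _↑ʳ_; splitAt; join; punchIn; punchOut; funToFin; finToFun)
  renaming (_≟_ to _≟ꟳ_)
open import Data.Fin.Properties using (remQuot-combine; combine-remQuot; combine-injective;
  splitAt⁻¹-↑ˡ; splitAt⁻¹-↑ʳ; splitAt-join; join-splitAt; ↑ˡ-injective;
  toℕ-↑ˡ; toℕ-↑ʳ; inject₁-injective; punchIn-injective; punchInᵢ≢i; punchOut-punchIn; punchOut-cong;
  toℕ-inject≤; fromℕ<-toℕ; fromℕ<-cong; toℕ<n; finToFun-funToFin; any?)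
open import Data.Fin.Subset using (Subset; ∣_∣; ⁅_⁆; Nonempty; _⊆_)
open import Data.Fin.Subset.Properties using (∣⁅x⁆∣≡1; x∈⁅y⁆⇒x≡y; x∈⁅x⁆; nonempty?; Empty-unique; ∣⊥∣≡0;
  p⊆q⇒∣p∣≤∣q∣)
open import Data.Vec using (Vec; []; _∷_; lookup; tabulate)
open import Data.Vec.Properties using (lookup∘tabulate; []=⇒lookup; lookup⇒[]=)
open import Data.List using (List; filter; length; allFin)
import Data.List as List
open import Data.List.Membership.Propositional using () renaming (_∈_ to _∈ₗ_)
open import Data.List.Membership.Propositional.Properties
  using (∈-allFin; ∈-map⁺; ∈-concatMap⁺; ∈-filter⁺; ∈-filter⁻; ∈-lookup)
open import Data.List.Relation.Unary.All as All using (All)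
open import Data.List.Relation.Unary.All.Properties using (all⁺; all⁻)
open import Data.List.Relation.Unary.Any as Any using (here; there; index)
open import Data.List.Relation.Unary.Any.Properties using (lookup-index)
open import Data.Maybe using (Maybe; just; nothing; fromMaybe)
open import Data.Product using (_×_; _,_; proj₁; proj₂; ∃)
open import Data.Sum using (_⊎_; inj₁; inj₂)
open import Data.Empty using (⊥-elim)
open import Function using (_∘_; Equivalence)
open import Function.Definitions using (Injective)
open import Relation.Nullary using (¬_; Dec; yes; no)
open import Relation.Nullary.Decidable using (isYes≗does; dec-false)
open import Relation.Binary.PropositionalEquality
  using (_≡_; _≢_; refl; sym; trans; cong; cong₂; subst; subst₂)

open Equivalence using (to; from)

≡false⇒≢true : ∀ {b} → b ≡ false → b ≢ true
≡false⇒≢true refl ()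

∧-true⁻ˡ : ∀ {a b} → (a ∧ b) ≡ true → a ≡ true
∧-true⁻ˡ {true} _ = refl

∧-true⁻ʳ : ∀ {a b} → (a ∧ b) ≡ true → b ≡ true
∧-true⁻ʳ {true} e = e

∧-true⁺ : ∀ {a b} → a ≡ true → b ≡ true → (a ∧ b) ≡ true
∧-true⁺ refl refl = refl

∨-true⁻ : ∀ {a b} → (a ∨ b) ≡ true → a ≡ true ⊎ b ≡ true
∨-true⁻ {true} _ = inj₁ refl
∨-true⁻ {false} e = inj₂ e

∨-true⁺ˡ : ∀ {a} b → a ≡ true → (a ∨ b) ≡ true
∨-true⁺ˡ b refl = refl

∨-true⁺ʳ : ∀ a {b} → b ≡ true → (a ∨ b) ≡ true
∨-true⁺ʳ true refl = refl
∨-true⁺ʳ false refl = refl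

all-true⁺ : ∀ {A : Set} (p : A → Bool) xs → (∀ x → p x ≡ true) → all p xs ≡ true
all-true⁺ p xs h = to T-≡ (all⁻ p (All.universal (λ x → from T-≡ (h x)) xs))

all-true⁻ : ∀ {m} (p : Fin m → Bool) → all p (allFin m) ≡ true → ∀ i → p i ≡ true
all-true⁻ {m} p e i = to T-≡ (All.lookup (all⁺ p (allFin m) (from T-≡ e)) (∈-allFin i))

==⇒≡ : ∀ {m} {a b : Fin m} → (a == b) ≡ true → a ≡ b
==⇒≡ {a = a} {b} e with a ≟ꟳ b
... | yes a≡b = a≡b
... | no _ = ⊥-elim (≡false⇒≢true refl e)

≢⇒==false : ∀ {m} {a b : Fin m} → a ≢ b → (a == b) ≡ false
≢⇒==false {a = a} {b} a≢b = trans (isYes≗does (a ≟ꟳ b)) (dec-false (a ≟ꟳ b) a≢b)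

==-∧-sym : ∀ {N} (P : Fin N → Bool) u v → ((u == v) ∧ P u) ≡ ((v == u) ∧ P v)
==-∧-sym P u v with u ≟ꟳ v
... | yes refl = cong (_∧ P u) (sym (==-refl u))
... | no u≢v = sym (cong (_∧ P v) (≢⇒==false (u≢v ∘ sym)))

not-∧∧-true⁺ : ∀ a b c → (a ≡ true → b ≡ true → c ≡ false) → not (a ∧ b ∧ c) ≡ true
not-∧∧-true⁺ false b c _ = refl
not-∧∧-true⁺ true false c _ = refl
not-∧∧-true⁺ true true c h rewrite h refl refl = refl

not-∧∧-true⁻ : ∀ {a b c} → not (a ∧ b ∧ c) ≡ true → a ≡ true → b ≡ true → c ≡ false
not-∧∧-true⁻ {c = false} _ _ _ = refl
not-∧∧-true⁻ {c = true} () refl refl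

-- Colorings as choice functions

IsChoiceColoring : ∀ {G m} → Cover G m → (Fin (n G) → Fin m) → Set
IsChoiceColoring {G} 𝓗 f = ∀ u v → hadj 𝓗 u (f u) v (f v) ≡ false

module _ {G : Graph} {m : ℕ} (𝓗 : Cover G m) (S : VSubset (n G) m) where

  isIndependent⁺ : (∀ u i v j → mem S u i ≡ true → mem S v j ≡ true → hadj 𝓗 u i v j ≡ false) →
                   isIndependent 𝓗 S ≡ true
  isIndependent⁺ indep =
    all-true⁺ _ (allFin (n G)) λ u → all-true⁺ _ (allFin m) λ i →
    all-true⁺ _ (allFin (n G)) λ v → all-true⁺ _ (allFin m) λ j →
    not-∧∧-true⁺ (mem S u i) (mem S v j) (hadj 𝓗 u i v j) (indep u i v j)

  isIndependent⁻ : isIndependent 𝓗 S ≡ true →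
                   ∀ u i v j → mem S u i ≡ true → mem S v j ≡ true → hadj 𝓗 u i v j ≡ false
  isIndependent⁻ indep u i v j =
    not-∧∧-true⁻ (all-true⁻ _ (all-true⁻ _ (all-true⁻ _ (all-true⁻ _ indep u) i) v) j)

size-tabulate : ∀ {a m} (g : Fin a → Subset m) → (∀ u → ∣ g u ∣ ≡ 1) → size (tabulate g) ≡ a
size-tabulate {zero} g _ = refl
size-tabulate {suc a} g h rewrite h zero = cong suc (size-tabulate (g ∘ suc) (h ∘ suc))

size-≤ : ∀ {a m} (S : VSubset a m) → (∀ u → ∣ lookup S u ∣ ≤ 1) → size S ≤ a
size-≤ [] _ = z≤n
size-≤ (r ∷ S) h = +-mono-≤ (h zero) (size-≤ S (h ∘ suc))

size-< : ∀ {a m} (S : VSubset a m) → (∀ u → ∣ lookup S u ∣ ≤ 1) →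
         ∀ u → ∣ lookup S u ∣ ≡ 0 → size S < a
size-< (r ∷ S) h zero r≡0 rewrite r≡0 = s≤s (size-≤ S (h ∘ suc))
size-< (r ∷ S) h (suc u) e = s≤s (≤-trans (+-monoˡ-≤ (size S) (h zero)) (size-< S (h ∘ suc) u e))

indicator : ∀ {a m} → (Fin a → Fin m) → VSubset a m
indicator f = tabulate (λ u → ⁅ f u ⁆)

module _ {a m : ℕ} (f : Fin a → Fin m) (u : Fin a) where

  mem-indicator : ∀ i → mem (indicator f) u i ≡ lookup ⁅ f u ⁆ i
  mem-indicator i = cong (λ r → lookup r i) (lookup∘tabulate (λ u → ⁅ f u ⁆) u)

  mem-indicator⁻ : ∀ {i} → mem (indicator f) u i ≡ true → i ≡ f u
  mem-indicator⁻ {i} e = x∈⁅y⁆⇒x≡y (f u) (lookup⇒[]= i ⁅ f u ⁆ (trans (sym (mem-indicator i)) e))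

  mem-indicator-self : mem (indicator f) u (f u) ≡ true
  mem-indicator-self = trans (mem-indicator (f u)) ([]=⇒lookup (x∈⁅x⁆ (f u)))

choice⇒isColoring : ∀ {G m} (𝓗 : Cover G m) {f} → IsChoiceColoring 𝓗 f →
                    isColoring 𝓗 (indicator f) ≡ true
choice⇒isColoring {G} 𝓗 {f} col =
  ∧-true⁺ (isIndependent⁺ 𝓗 (indicator f) indep) (to T-≡ (≡⇒≡ᵇ _ _ size≡))
  where
  indep : ∀ u i v j → mem (indicator f) u i ≡ true → mem (indicator f) v j ≡ true →
          hadj 𝓗 u i v j ≡ false
  indep u i v j ui vj with mem-indicator⁻ f u ui | mem-indicator⁻ f v vj
  ... | refl | refl = col u v
  size≡ : size (indicator f) ≡ n G
  size≡ = size-tabulate _ (λ u → ∣⁅x⁆∣≡1 (f u))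

choice⇒HasColoring : ∀ {G m} (𝓗 : Cover G m) {f} → IsChoiceColoring 𝓗 f → HasColoring 𝓗
choice⇒HasColoring 𝓗 col = indicator _ , choice⇒isColoring 𝓗 col

module _ {G : Graph} {m : ℕ} (𝓗 : Cover G m) (S : VSubset (n G) m) (S-col : isColoring 𝓗 S ≡ true) where

  coloring-independent : ∀ u i v j → mem S u i ≡ true → mem S v j ≡ true → hadj 𝓗 u i v j ≡ false
  coloring-independent = isIndependent⁻ 𝓗 S (∧-true⁻ˡ S-col)

  coloring-row-unique : ∀ u {i j} → mem S u i ≡ true → mem S u j ≡ true → i ≡ j
  coloring-row-unique u {i} {j} ui uj with i ≟ꟳ j
  ... | yes i≡j = i≡j
  ... | no i≢j = ⊥-elim (≡false⇒≢true (coloring-independent u i u j ui uj) (clique 𝓗 u i j i≢j))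

  coloring-row-≤1 : ∀ u → ∣ lookup S u ∣ ≤ 1
  coloring-row-≤1 u with nonempty? (lookup S u)
  ... | yes (i , i∈) = ≤-trans (p⊆q⇒∣p∣≤∣q∣ ⊆⁅i⁆) (≤-reflexive (∣⁅x⁆∣≡1 i))
    where
    ⊆⁅i⁆ : lookup S u ⊆ ⁅ i ⁆
    ⊆⁅i⁆ {j} j∈ rewrite coloring-row-unique u ([]=⇒lookup j∈) ([]=⇒lookup i∈) = x∈⁅x⁆ i
  ... | no empty rewrite Empty-unique empty | ∣⊥∣≡0 m = z≤n

  coloring-row-nonempty : ∀ u → Nonempty (lookup S u)
  coloring-row-nonempty u with nonempty? (lookup S u)
  ... | yes ne = ne
  ... | no empty = ⊥-elim (<-irrefl size≡ (size-< S coloring-row-≤1 u ∣row∣≡0))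
    where
    size≡ : size S ≡ n G
    size≡ = ≡ᵇ⇒≡ (size S) (n G) (from T-≡ (∧-true⁻ʳ {isIndependent 𝓗 S} S-col))
    ∣row∣≡0 : ∣ lookup S u ∣ ≡ 0
    ∣row∣≡0 rewrite Empty-unique empty = ∣⊥∣≡0 m

  coloring⇒choice : ∃ (IsChoiceColoring 𝓗)
  coloring⇒choice = f , λ u v → coloring-independent u (f u) v (f v) (mem-f u) (mem-f v)
    where
    f : Fin (n G) → Fin m
    f u = proj₁ (coloring-row-nonempty u)
    mem-f : ∀ u → mem S u (f u) ≡ true
    mem-f u = []=⇒lookup (proj₂ (coloring-row-nonempty u))

HasColoring⇒choice : ∀ {G m} (𝓗 : Cover G m) → HasColoring 𝓗 → ∃ (IsChoiceColoring 𝓗)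
HasColoring⇒choice 𝓗 (S , S-col) = coloring⇒choice 𝓗 S S-col

restrictCover : ∀ {G M c} (𝓒 : Cover G M) (e : Fin (n G) → Fin c → Fin M) →
                (∀ u → Injective _≡_ _≡_ (e u)) → Cover G c
restrictCover 𝓒 e e-inj = record
  { hadj = λ u i v j → hadj 𝓒 u (e u i) v (e v j)
  ; hadj-sym = λ u i v j → hadj-sym 𝓒 u (e u i) v (e v j)
  ; hadj-irrefl = λ v i → hadj-irrefl 𝓒 v (e v i)
  ; clique = λ v i j i≢j → clique 𝓒 v (e v i) (e v j) (i≢j ∘ e-inj v)
  ; respects = λ u i v j → respects 𝓒 u (e u i) v (e v j)
  ; matchingˡ = λ u v uv i j j′ p q → e-inj v (matchingˡ 𝓒 u v uv (e u i) (e v j) (e v j′) p q)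
  ; matchingʳ = λ u v uv i i′ j p q → e-inj u (matchingʳ 𝓒 u v uv (e u i) (e u i′) (e v j) p q)
  }

emptyCover : ∀ G → Cover G 0
emptyCover G = record
  { hadj = λ _ ()
  ; hadj-sym = λ _ ()
  ; hadj-irrefl = λ _ ()
  ; clique = λ _ ()
  ; respects = λ _ ()
  ; matchingˡ = λ _ _ _ ()
  ; matchingʳ = λ _ _ _ ()
  }

¬DPColorable-zero : ∀ G → 0 < n G → ¬ DPColorable G 0
¬DPColorable-zero G 0<n D with proj₁ (HasColoring⇒choice (emptyCover G) (D (emptyCover G))) (fromℕ< 0<n)
... | ()

DPColorable-suc : ∀ G m → DPColorable G m → DPColorable G (suc m)
DPColorable-suc G m D 𝓗 = choice⇒HasColoring 𝓗 {inject₁ ∘ proj₁ choice} (proj₂ choice)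
  where
  𝓗′ : Cover G m
  𝓗′ = restrictCover 𝓗 (λ _ → inject₁) (λ _ → inject₁-injective)
  choice : ∃ (IsChoiceColoring 𝓗′)
  choice = HasColoring⇒choice 𝓗′ (D 𝓗′)

DPColorable-mono : ∀ G {m m′} → m ≤ m′ → DPColorable G m → DPColorable G m′
DPColorable-mono G {m′ = zero} z≤n D = D
DPColorable-mono G {m′ = suc m′} m≤1+m′ D with m≤n⇒m<n∨m≡n m≤1+m′
... | inj₁ (s≤s m≤m′) = DPColorable-suc G m′ (DPColorable-mono G m≤m′ D)
... | inj₂ refl = D

choiceColoring-byEdges : ∀ {G m} (𝓗 : Cover G m) (f : Fin (n G) → Fin m) →
  (∀ u v → u ≢ v → adj G u v ≡ true → hadj 𝓗 u (f u) v (f v) ≢ true) → IsChoiceColoring 𝓗 f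
choiceColoring-byEdges 𝓗 f no-edge u v with u ≟ꟳ v
... | yes refl = hadj-irrefl 𝓗 u (f u)
... | no u≢v with hadj 𝓗 u (f u) v (f v) in e
...   | false = refl
...   | true with respects 𝓗 u (f u) v (f v) e
...     | inj₁ u≡v = ⊥-elim (u≢v u≡v)
...     | inj₂ uv = ⊥-elim (no-edge u v u≢v uv e)

-- The product G □ K k t

productAdj : (G H : Graph) → Fin (n G) → Fin (n H) → Fin (n G) → Fin (n H) → Bool
productAdj G H u w v w′ = ((u == v) ∧ adj H w w′) ∨ ((w == w′) ∧ adj G u v)

adj-□-combine : ∀ (G H : Graph) u w v w′ →
                adj (G □ H) (combine u w) (combine v w′) ≡ productAdj G H u w v w′
adj-□-combine G H u w v w′ =
  cong₂ (λ x y → productAdj G H (proj₁ x) (proj₂ x) (proj₁ y) (proj₂ y))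
        (remQuot-combine {n G} {n H} u w) (remQuot-combine {n G} {n H} v w′)

layerCover : ∀ {G H M} → Cover (G □ H) M → Fin (n H) → Cover G M
layerCover {G} {H} 𝓗 w = record
  { hadj = λ u i v j → hadj 𝓗 (combine u w) i (combine v w) j
  ; hadj-sym = λ u i v j → hadj-sym 𝓗 (combine u w) i (combine v w) j
  ; hadj-irrefl = λ v i → hadj-irrefl 𝓗 (combine v w) i
  ; clique = λ v → clique 𝓗 (combine v w)
  ; respects = layer-respects
  ; matchingˡ = λ u v uv → matchingˡ 𝓗 (combine u w) (combine v w) (layer-adj uv)
  ; matchingʳ = λ u v uv → matchingʳ 𝓗 (combine u w) (combine v w) (layer-adj uv)
  }
  where
  layer-adj : ∀ {u v} → adj G u v ≡ true → adj (G □ H) (combine u w) (combine v w) ≡ true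
  layer-adj {u} {v} uv = trans (adj-□-combine G H u w v w) (∨-true⁺ʳ _ (∧-true⁺ (==-refl w) uv))
  layer-respects : ∀ u i v j → hadj 𝓗 (combine u w) i (combine v w) j ≡ true →
                   (u ≡ v) ⊎ (adj G u v ≡ true)
  layer-respects u i v j e with respects 𝓗 (combine u w) i (combine v w) j e
  ... | inj₁ eq = inj₁ (proj₁ (combine-injective u w v w eq))
  ... | inj₂ uv with ∨-true⁻ {(u == v) ∧ adj H w w} (trans (sym (adj-□-combine G H u w v w)) uv)
  ...   | inj₁ ww = ⊥-elim (≡false⇒≢true (adj-irrefl H w) (∧-true⁻ʳ {u == v} ww))
  ...   | inj₂ uv′ = inj₂ (∧-true⁻ʳ {w == w} uv′)

isInj₁ : ∀ {A B : Set} → A ⊎ B → Bool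
isInj₁ (inj₁ _) = true
isInj₁ (inj₂ _) = false

join-<ᵇ : ∀ k t (s : Fin k ⊎ Fin t) → (toℕ (join k t s) <ᵇ k) ≡ isInj₁ s
join-<ᵇ k t (inj₁ a) = to T-≡ (<⇒<ᵇ (subst (_< k) (sym (toℕ-↑ˡ a t)) (toℕ<n a)))
join-<ᵇ k t (inj₂ b) =
  ¬-not λ k+b<k → m+n≮m k (toℕ b) (subst (_< k) (toℕ-↑ʳ k b) (<ᵇ⇒< _ k (from T-≡ k+b<k)))

K-adj-join : ∀ k t s s′ → adj (K k t) (join k t s) (join k t s′) ≡ (isInj₁ s xor isInj₁ s′)
K-adj-join k t s s′ = cong₂ _xor_ (join-<ᵇ k t s) (join-<ᵇ k t s′)

module Coordinates (G : Graph) (k t : ℕ) where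

  vertex : Fin (n G) → Fin k ⊎ Fin t → Fin (n (G □ K k t))
  vertex u s = combine u (join k t s)

  base : Fin (n (G □ K k t)) → Fin (n G)
  base = π₁ G (K k t)

  side : Fin (n (G □ K k t)) → Fin k ⊎ Fin t
  side x = splitAt k (π₂ G (K k t) x)

  vertex-base-side : ∀ x → vertex (base x) (side x) ≡ x
  vertex-base-side x = trans (cong (combine (base x)) (join-splitAt k t (π₂ G (K k t) x)))
                             (combine-remQuot {n G} (k + t) x)

  base-vertex : ∀ u s → base (vertex u s) ≡ u
  base-vertex u s = cong proj₁ (remQuot-combine {n G} {k + t} u (join k t s))

  side-vertex : ∀ u s → side (vertex u s) ≡ s
  side-vertex u s = trans (cong (splitAt k ∘ proj₂) (remQuot-combine {n G} {k + t} u (join k t s)))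
                          (splitAt-join k t s)

  vertex-injective : ∀ u s v s′ → vertex u s ≡ vertex v s′ → u ≡ v × s ≡ s′
  vertex-injective u s v s′ eq =
    trans (sym (base-vertex u s)) (trans (cong base eq) (base-vertex v s′)) ,
    trans (sym (side-vertex u s)) (trans (cong side eq) (side-vertex v s′))

  adj-vertex⁻ : ∀ u s v s′ → adj (G □ K k t) (vertex u s) (vertex v s′) ≡ true →
                (s ≡ s′ × adj G u v ≡ true) ⊎ (u ≡ v × (isInj₁ s xor isInj₁ s′) ≡ true)
  adj-vertex⁻ u s v s′ e with ∨-true⁻ {(u == v) ∧ adj (K k t) (join k t s) (join k t s′)}
                                (trans (sym (adj-□-combine G (K k t) u (join k t s) v (join k t s′))) e)
  ... | inj₁ link =
    inj₂ (==⇒≡ (∧-true⁻ˡ link) , trans (sym (K-adj-join k t s s′)) (∧-true⁻ʳ {u == v} link))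
  ... | inj₂ layer = inj₁ (proj₂ (vertex-injective u s u s′ (cong (combine u) (==⇒≡ (∧-true⁻ˡ layer))))
                         , ∧-true⁻ʳ {join k t s == join k t s′} layer)

  adj-vertex⁺ : ∀ u s v s′ → (s ≡ s′ × adj G u v ≡ true) ⊎ (u ≡ v × (isInj₁ s xor isInj₁ s′) ≡ true) →
                adj (G □ K k t) (vertex u s) (vertex v s′) ≡ true
  adj-vertex⁺ u s v s′ edge =
    trans (adj-□-combine G (K k t) u (join k t s) v (join k t s′)) (productAdj-true edge)
    where
    productAdj-true : (s ≡ s′ × adj G u v ≡ true) ⊎ (u ≡ v × (isInj₁ s xor isInj₁ s′) ≡ true) →
                      productAdj G (K k t) u (join k t s) v (join k t s′) ≡ true
    productAdj-true (inj₁ (refl , uv)) = ∨-true⁺ʳ _ (∧-true⁺ (==-refl (join k t s)) uv)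
    productAdj-true (inj₂ (refl , link)) =
      ∨-true⁺ˡ _ (∧-true⁺ (==-refl u) (trans (K-adj-join k t s s′) link))

-- Upper bound

punchOutᵐ : ∀ {N} → Fin (suc N) → Maybe (Fin (suc N)) → Maybe (Fin N)
punchOutᵐ h nothing = nothing
punchOutᵐ h (just y) with h ≟ꟳ y
... | yes _ = nothing
... | no h≢y = just (punchOut h≢y)

punchOutᵐ-punchIn : ∀ {N} (h : Fin (suc N)) z → punchOutᵐ h (just (punchIn h z)) ≡ just z
punchOutᵐ-punchIn h z with h ≟ꟳ punchIn h z
... | yes h≡ = ⊥-elim (punchInᵢ≢i h z (sym h≡))
... | no h≢ = cong just (trans (punchOut-cong h refl) (punchOut-punchIn h))

-- Each step skips one value; an absent ys a (nothing) skips an arbitrary one, which keeps M = k + N.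
avoiding : ∀ k {N M} → M ≡ k + N → (Fin k → Maybe (Fin M)) → Fin N → Fin M
avoiding zero refl _ x = x
avoiding (suc k) {N} refl ys x =
  punchIn h (avoiding k refl (λ a → punchOutᵐ h (ys (suc a))) x)
  where
  h : Fin (suc (k + N))
  h = fromMaybe zero (ys zero)

avoiding-injective : ∀ k {N M} (eq : M ≡ k + N) ys → Injective _≡_ _≡_ (avoiding k eq ys)
avoiding-injective zero refl ys e = e
avoiding-injective (suc k) refl ys e =
  avoiding-injective k refl _ (punchIn-injective (fromMaybe zero (ys zero)) _ _ e)

avoiding-misses : ∀ k {N M} (eq : M ≡ k + N) ys a x → ys a ≢ just (avoiding k eq ys x)
avoiding-misses (suc k) refl ys zero x e = punchInᵢ≢i _ _ (sym (cong (fromMaybe zero) e))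
avoiding-misses (suc k) {N} refl ys (suc a) x e =
  avoiding-misses k refl _ a x (trans (cong (punchOutᵐ h) e) (punchOutᵐ-punchIn h _))
  where
  h : Fin (suc (k + N))
  h = fromMaybe zero (ys zero)

witness : ∀ {m} → (Fin m → Bool) → Maybe (Fin m)
witness p with any? (λ y → p y Bool.≟ true)
... | yes (y , _) = just y
... | no _ = nothing

witness-unique : ∀ {m} (p : Fin m → Bool) {y} → p y ≡ true → (∀ {y′} → p y′ ≡ true → y′ ≡ y) →
                 witness p ≡ just y
witness-unique p {y} py unique with any? (λ y → p y Bool.≟ true)
... | yes (y′ , py′) = cong just (unique py′)
... | no none = ⊥-elim (none (y , py))

module UpperBound {G : Graph} {k t c : ℕ} (G-col : DPColorable G c) (𝓗 : Cover (G □ K k t) (c + k)) where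

  open Coordinates G k t

  layer : Fin k ⊎ Fin t → Cover G (c + k)
  layer s = layerCover {G} {K k t} 𝓗 (join k t s)

  A-cover : Fin k → Cover G c
  A-cover a = restrictCover (layer (inj₁ a)) (λ _ → _↑ˡ k) (λ _ → ↑ˡ-injective k _ _)

  A-choice : ∀ a → ∃ (IsChoiceColoring (A-cover a))
  A-choice a = HasColoring⇒choice (A-cover a) (G-col (A-cover a))

  A-color : Fin k → Fin (n G) → Fin (c + k)
  A-color a u = proj₁ (A-choice a) u ↑ˡ k

  blocked : Fin t → Fin (n G) → Fin k → Maybe (Fin (c + k))
  blocked b u a = witness (hadj 𝓗 (vertex u (inj₁ a)) (A-color a u) (vertex u (inj₂ b)))

  B-cover : Fin t → Cover G c
  B-cover b = restrictCover (layer (inj₂ b)) (λ u → avoiding k (+-comm c k) (blocked b u))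
                            (λ u → avoiding-injective k (+-comm c k) (blocked b u))

  B-choice : ∀ b → ∃ (IsChoiceColoring (B-cover b))
  B-choice b = HasColoring⇒choice (B-cover b) (G-col (B-cover b))

  color : Fin (n G) → Fin k ⊎ Fin t → Fin (c + k)
  color u (inj₁ a) = A-color a u
  color u (inj₂ b) = avoiding k (+-comm c k) (blocked b u) (proj₁ (B-choice b) u)

  color-layer : ∀ s → IsChoiceColoring (layer s) (λ u → color u s)
  color-layer (inj₁ a) = proj₂ (A-choice a)
  color-layer (inj₂ b) = proj₂ (B-choice b)

  color-link : ∀ u a b → hadj 𝓗 (vertex u (inj₁ a)) (color u (inj₁ a))
                                  (vertex u (inj₂ b)) (color u (inj₂ b)) ≢ true
  color-link u a b e = avoiding-misses k (+-comm c k) (blocked b u) a (proj₁ (B-choice b) u)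
    (witness-unique _ e (λ e′ → matchingˡ 𝓗 _ _ ab-edge _ _ _ e′ e))
    where
    ab-edge : adj (G □ K k t) (vertex u (inj₁ a)) (vertex u (inj₂ b)) ≡ true
    ab-edge = adj-vertex⁺ u (inj₁ a) u (inj₂ b) (inj₂ (refl , refl))

  color-proper : ∀ u s v s′ → hadj 𝓗 (vertex u s) (color u s) (vertex v s′) (color v s′) ≡ false
  color-proper u s v s′ with hadj 𝓗 (vertex u s) (color u s) (vertex v s′) (color v s′) in e
  ... | false = refl
  ... | true with respects 𝓗 _ _ _ _ e
  ...   | inj₁ same with vertex-injective u s v s′ same
  ...     | refl , refl = ⊥-elim (≡false⇒≢true (hadj-irrefl 𝓗 _ _) e)
  color-proper u s v s′ | true | inj₂ edge with adj-vertex⁻ u s v s′ edge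
  ... | inj₁ (refl , _) = ⊥-elim (≡false⇒≢true (color-layer s u v) e)
  color-proper u (inj₁ a) v (inj₂ b) | true | inj₂ _ | inj₂ (refl , _) = ⊥-elim (color-link u a b e)
  color-proper u (inj₂ b) v (inj₁ a) | true | inj₂ _ | inj₂ (refl , _) =
    ⊥-elim (color-link u a b (trans (hadj-sym 𝓗 _ _ _ _) e))
  color-proper u (inj₁ _) v (inj₁ _) | true | inj₂ _ | inj₂ (refl , ())
  color-proper u (inj₂ _) v (inj₂ _) | true | inj₂ _ | inj₂ (refl , ())

  F : Fin (n (G □ K k t)) → Fin (c + k)
  F x = color (base x) (side x)

  coloring : IsChoiceColoring 𝓗 F
  coloring x y =
    subst₂ (λ x′ y′ → hadj 𝓗 x′ (F x) y′ (F y) ≡ false) (vertex-base-side x) (vertex-base-side y)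
      (color-proper (base x) (side x) (base y) (side y))

DPColorable-□K : ∀ G k t c → DPColorable G c → DPColorable (G □ K k t) (c + k)
DPColorable-□K G k t c G-col 𝓗 = choice⇒HasColoring 𝓗 (UpperBound.coloring G-col 𝓗)

-- Lower bound

allVecs-complete : ∀ {A : Set} (xs : List A) → (∀ x → x ∈ₗ xs) → ∀ k (v : Vec A k) → v ∈ₗ allVecs xs k
allVecs-complete xs xs-complete zero [] = here refl
allVecs-complete xs xs-complete (suc k) (x ∷ v) =
  ∈-concatMap⁺ (λ y → List.map (y ∷_) (allVecs xs k))
    (Any.map (λ { refl → ∈-map⁺ (x ∷_) (allVecs-complete xs xs-complete k v) }) (xs-complete x))

allVSubsets-complete : ∀ a m (S : VSubset a m) → S ∈ₗ allVSubsets a m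
allVSubsets-complete a m = allVecs-complete _ (allVecs-complete _ bool-complete m) a
  where
  bool-complete : ∀ b → b ∈ₗ true List.∷ false List.∷ List.[]
  bool-complete true = here refl
  bool-complete false = there (here refl)

-- Color c′ ↑ʳ a is the one reserved for links to the A-vertex a.  A B-vertex b < q ^ k stands for
-- the tuple finToFun b of indices into colorings; the B-vertices b ≥ q ^ k get no links.
module LowerBound {G : Graph} {k t c′ : ℕ} (𝓗₀ : Cover G (c′ + k)) where

  open Coordinates G k t

  isColoring? : ∀ S → Dec (isColoring 𝓗₀ S ≡ true)
  isColoring? S = isColoring 𝓗₀ S Bool.≟ true

  colorings : List (VSubset (n G) (c′ + k))
  colorings = filter isColoring? (allVSubsets (n G) (c′ + k))

  q : ℕ
  q = length colorings

  colorings-isColoring : ∀ i → isColoring 𝓗₀ (List.lookup colorings i) ≡ true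
  colorings-isColoring i = proj₂ (∈-filter⁻ isColoring? {xs = allVSubsets (n G) (c′ + k)} (∈-lookup i))

  colorings-complete : ∀ {f} → IsChoiceColoring 𝓗₀ f → indicator f ∈ₗ colorings
  colorings-complete {f} col =
    ∈-filter⁺ isColoring? (allVSubsets-complete _ _ (indicator f)) (choice⇒isColoring 𝓗₀ col)

  decode : Fin t → Maybe (Fin k → Fin q)
  decode b with toℕ b <ℕ? q ^ k
  ... | yes b<q^k = just (finToFun (fromℕ< b<q^k))
  ... | no _ = nothing

  decode-inject≤ : (q^k≤t : q ^ k ≤ t) (e : Fin (q ^ k)) → decode (inject≤ e q^k≤t) ≡ just (finToFun e)
  decode-inject≤ q^k≤t e with toℕ (inject≤ e q^k≤t) <ℕ? q ^ k
  ... | yes lt = cong (just ∘ finToFun)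
    (trans (fromℕ<-cong _ _ (toℕ-inject≤ e q^k≤t) lt (toℕ<n e)) (fromℕ<-toℕ e (toℕ<n e)))
  ... | no ≮ = ⊥-elim (≮ (subst (_< q ^ k) (sym (toℕ-inject≤ e q^k≤t)) (toℕ<n e)))

  module _ (𝓑 : Cover G c′) where

    B-edge : Fin (n G) → Fin c′ ⊎ Fin k → Fin (n G) → Fin c′ ⊎ Fin k → Bool
    B-edge u (inj₁ i) v (inj₁ j) = hadj 𝓑 u i v j
    B-edge u (inj₁ _) v (inj₂ _) = false
    B-edge u (inj₂ _) v _ = false

    link : Maybe (Fin k → Fin q) → Fin (n G) → Fin k → Fin (c′ + k) → Fin (c′ + k) → Bool
    link nothing _ _ _ _ = false
    link (just τ) u a α β = (β == (c′ ↑ʳ a)) ∧ mem (List.lookup colorings (τ a)) u α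

    edge : Fin (n G) → Fin k ⊎ Fin t → Fin (c′ + k) → Fin (n G) → Fin k ⊎ Fin t → Fin (c′ + k) → Bool
    edge u (inj₁ a) α v (inj₁ a′) β = (a == a′) ∧ (adj G u v ∧ hadj 𝓗₀ u α v β)
    edge u (inj₂ b) α v (inj₂ b′) β = (b == b′) ∧ (adj G u v ∧ B-edge u (splitAt c′ α) v (splitAt c′ β))
    edge u (inj₁ a) α v (inj₂ b) β = (u == v) ∧ link (decode b) u a α β
    edge u (inj₂ b) α v (inj₁ a) β = (u == v) ∧ link (decode b) u a β α

    B-edge-sym : ∀ u σ v σ′ → B-edge u σ v σ′ ≡ B-edge v σ′ u σ
    B-edge-sym u (inj₁ i) v (inj₁ j) = hadj-sym 𝓑 u i v j
    B-edge-sym u (inj₁ _) v (inj₂ _) = refl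
    B-edge-sym u (inj₂ _) v (inj₁ _) = refl
    B-edge-sym u (inj₂ _) v (inj₂ _) = refl

    edge-sym : ∀ u s α v s′ β → edge u s α v s′ β ≡ edge v s′ β u s α
    edge-sym u (inj₁ a) α v (inj₁ a′) β =
      cong₂ _∧_ (==-sym a a′) (cong₂ _∧_ (adj-sym G u v) (hadj-sym 𝓗₀ u α v β))
    edge-sym u (inj₂ b) α v (inj₂ b′) β =
      cong₂ _∧_ (==-sym b b′) (cong₂ _∧_ (adj-sym G u v) (B-edge-sym u (splitAt c′ α) v (splitAt c′ β)))
    edge-sym u (inj₁ a) α v (inj₂ b) β = ==-∧-sym (λ w → link (decode b) w a α β) u v
    edge-sym u (inj₂ b) α v (inj₁ a) β = ==-∧-sym (λ w → link (decode b) w a β α) u v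

    edge-adj : ∀ u s α v s′ β → edge u s α v s′ β ≡ true →
               (s ≡ s′ × adj G u v ≡ true) ⊎ (u ≡ v × (isInj₁ s xor isInj₁ s′) ≡ true)
    edge-adj u (inj₁ a) α v (inj₁ a′) β e =
      inj₁ (cong inj₁ (==⇒≡ (∧-true⁻ˡ e)) , ∧-true⁻ˡ (∧-true⁻ʳ {a == a′} e))
    edge-adj u (inj₂ b) α v (inj₂ b′) β e =
      inj₁ (cong inj₂ (==⇒≡ (∧-true⁻ˡ e)) , ∧-true⁻ˡ (∧-true⁻ʳ {b == b′} e))
    edge-adj u (inj₁ a) α v (inj₂ b) β e = inj₂ (==⇒≡ (∧-true⁻ˡ e) , refl)
    edge-adj u (inj₂ b) α v (inj₁ a) β e = inj₂ (==⇒≡ (∧-true⁻ˡ e) , refl)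

    link-reserved : ∀ m u a α β → link m u a α β ≡ true → β ≡ c′ ↑ʳ a
    link-reserved (just τ) u a α β e = ==⇒≡ (∧-true⁻ˡ e)

    link-unique : ∀ m u a α α′ β → link m u a α β ≡ true → link m u a α′ β ≡ true → α ≡ α′
    link-unique (just τ) u a α α′ β e e′ =
      coloring-row-unique 𝓗₀ (List.lookup colorings (τ a)) (colorings-isColoring (τ a)) u
        (∧-true⁻ʳ {β == (c′ ↑ʳ a)} e) (∧-true⁻ʳ {β == (c′ ↑ʳ a)} e′)

    B-edge-matching : ∀ u v → adj G u v ≡ true → ∀ α β β′ →
      B-edge u (splitAt c′ α) v (splitAt c′ β) ≡ true → B-edge u (splitAt c′ α) v (splitAt c′ β′) ≡ true →
      β ≡ β′
    B-edge-matching u v uv α β β′ e e′ with splitAt c′ α | splitAt c′ β in eβ | splitAt c′ β′ in eβ′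
    ... | inj₁ i | inj₁ j | inj₁ j′ with matchingˡ 𝓑 u v uv i j j′ e e′
    ...   | refl = trans (sym (splitAt⁻¹-↑ˡ eβ)) (splitAt⁻¹-↑ˡ eβ′)

    edge-matching : ∀ u s α v s′ β β′ → edge u s α v s′ β ≡ true → edge u s α v s′ β′ ≡ true → β ≡ β′
    edge-matching u (inj₁ a) α v (inj₁ a′) β β′ e e′ =
      matchingˡ 𝓗₀ u v (∧-true⁻ˡ (∧-true⁻ʳ {a == a′} e)) α β β′
        (∧-true⁻ʳ (∧-true⁻ʳ {a == a′} e)) (∧-true⁻ʳ (∧-true⁻ʳ {a == a′} e′))
    edge-matching u (inj₂ b) α v (inj₂ b′) β β′ e e′ =
      B-edge-matching u v (∧-true⁻ˡ (∧-true⁻ʳ {b == b′} e)) α β β′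
        (∧-true⁻ʳ (∧-true⁻ʳ {b == b′} e)) (∧-true⁻ʳ (∧-true⁻ʳ {b == b′} e′))
    edge-matching u (inj₁ a) α v (inj₂ b) β β′ e e′ =
      trans (link-reserved (decode b) u a α β (∧-true⁻ʳ {u == v} e))
            (sym (link-reserved (decode b) u a α β′ (∧-true⁻ʳ {u == v} e′)))
    edge-matching u (inj₂ b) α v (inj₁ a) β β′ e e′ =
      link-unique (decode b) u a β β′ α (∧-true⁻ʳ {u == v} e) (∧-true⁻ʳ {u == v} e′)

    ladj : Fin (n (G □ K k t)) → Fin (c′ + k) → Fin (n (G □ K k t)) → Fin (c′ + k) → Bool
    ladj x α y β = if x == y then not (α == β) else edge (base x) (side x) α (base y) (side y) β

    ladj-sym : ∀ x α y β → ladj x α y β ≡ ladj y β x α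
    ladj-sym x α y β rewrite ==-sym x y with y == x
    ... | true = cong not (==-sym α β)
    ... | false = edge-sym (base x) (side x) α (base y) (side y) β

    ladj-irrefl : ∀ x α → ladj x α x α ≡ false
    ladj-irrefl x α rewrite ==-refl x | ==-refl α = refl

    ladj-clique : ∀ x α β → α ≢ β → ladj x α x β ≡ true
    ladj-clique x α β α≢β rewrite ==-refl x | ≢⇒==false α≢β = refl

    ladj-respects : ∀ x α y β → ladj x α y β ≡ true → (x ≡ y) ⊎ (adj (G □ K k t) x y ≡ true)
    ladj-respects x α y β e with x == y in x==y
    ... | true = inj₁ (==⇒≡ x==y)
    ... | false =
      inj₂ (subst₂ (λ x′ y′ → adj (G □ K k t) x′ y′ ≡ true) (vertex-base-side x) (vertex-base-side y)
                   (adj-vertex⁺ (base x) (side x) (base y) (side y)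
                                (edge-adj (base x) (side x) α (base y) (side y) β e)))

    ladj-matching : ∀ x y → adj (G □ K k t) x y ≡ true →
                    ∀ α β β′ → ladj x α y β ≡ true → ladj x α y β′ ≡ true → β ≡ β′
    ladj-matching x y xy α β β′ e e′ with x == y in x==y
    ... | true with ==⇒≡ x==y
    ...   | refl = ⊥-elim (≡false⇒≢true (adj-irrefl (G □ K k t) x) xy)
    ladj-matching x y xy α β β′ e e′ | false =
      edge-matching (base x) (side x) α (base y) (side y) β β′ e e′

    cover : Cover (G □ K k t) (c′ + k)
    cover = record
      { hadj = ladj
      ; hadj-sym = ladj-sym
      ; hadj-irrefl = ladj-irrefl
      ; clique = ladj-clique
      ; respects = ladj-respects
      ; matchingˡ = ladj-matching
      ; matchingʳ = λ x y xy α α′ β e e′ →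
          ladj-matching y x (trans (adj-sym (G □ K k t) y x) xy) β α α′
            (trans (ladj-sym y β x α) e) (trans (ladj-sym y β x α′) e′)
      }

    ladj-vertex : ∀ u s v s′ α β → vertex u s ≢ vertex v s′ →
                  ladj (vertex u s) α (vertex v s′) β ≡ edge u s α v s′ β
    ladj-vertex u s v s′ α β ≢ rewrite ≢⇒==false ≢ | base-vertex u s | side-vertex u s
                                              | base-vertex v s′ | side-vertex v s′ = refl

    module _ (q^k≤t : q ^ k ≤ t) {F : Fin (n (G □ K k t)) → Fin (c′ + k)}
             (F-col : IsChoiceColoring cover F) where

      F-proper : ∀ {u s v s′} → vertex u s ≢ vertex v s′ →
                 edge u s (F (vertex u s)) v s′ (F (vertex v s′)) ≢ true
      F-proper {u} {s} {v} {s′} ≢ e = ≡false⇒≢true (F-col (vertex u s) (vertex v s′))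
        (trans (ladj-vertex u s v s′ (F (vertex u s)) (F (vertex v s′)) ≢) e)

      A-color : Fin k → Fin (n G) → Fin (c′ + k)
      A-color a u = F (vertex u (inj₁ a))

      A-color-col : ∀ a → IsChoiceColoring 𝓗₀ (A-color a)
      A-color-col a = choiceColoring-byEdges 𝓗₀ (A-color a) λ u v u≢v uv e →
        F-proper {u} {inj₁ a} {v} {inj₁ a} (u≢v ∘ proj₁ ∘ vertex-injective u (inj₁ a) v (inj₁ a))
          (∧-true⁺ (==-refl a) (∧-true⁺ uv e))

      τ : Fin k → Fin q
      τ a = index (colorings-complete (A-color-col a))

      b : Fin t
      b = inject≤ (funToFin τ) q^k≤t

      link-b : ∀ a u → link (decode b) u a (A-color a u) (c′ ↑ʳ a) ≡ true
      link-b a u rewrite decode-inject≤ q^k≤t (funToFin τ) | finToFun-funToFin τ a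
                       | sym (lookup-index (colorings-complete (A-color-col a))) =
        ∧-true⁺ (==-refl (c′ ↑ʳ a)) (mem-indicator-self (A-color a) u)

      B-avoids-reserved : ∀ a u → F (vertex u (inj₂ b)) ≢ c′ ↑ʳ a
      B-avoids-reserved a u eq =
        F-proper {u} {inj₁ a} {u} {inj₂ b} ((λ ()) ∘ proj₂ ∘ vertex-injective u (inj₁ a) u (inj₂ b))
          (∧-true⁺ (==-refl u)
            (subst (λ β → link (decode b) u a (A-color a u) β ≡ true) (sym eq) (link-b a u)))

      B-ordinary : ∀ u → ∃ λ j → splitAt c′ (F (vertex u (inj₂ b))) ≡ inj₁ j
      B-ordinary u with splitAt c′ (F (vertex u (inj₂ b))) in eq
      ... | inj₁ j = j , refl
      ... | inj₂ a = ⊥-elim (B-avoids-reserved a u (sym (splitAt⁻¹-↑ʳ eq)))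

      B-color : Fin (n G) → Fin c′
      B-color u = proj₁ (B-ordinary u)

      B-color-col : IsChoiceColoring 𝓑 B-color
      B-color-col = choiceColoring-byEdges 𝓑 B-color λ u v u≢v uv e →
        F-proper {u} {inj₂ b} {v} {inj₂ b} (u≢v ∘ proj₁ ∘ vertex-injective u (inj₂ b) v (inj₂ b))
          (∧-true⁺ (==-refl b) (∧-true⁺ uv
            (subst₂ (λ σ σ′ → B-edge u σ v σ′ ≡ true)
                    (sym (proj₂ (B-ordinary u))) (sym (proj₂ (B-ordinary v))) e)))

DPColorable-□K⁻ : ∀ {G k t c′} (𝓗₀ : Cover G (c′ + k)) → P-DP-cover 𝓗₀ ^ k ≤ t →
                  DPColorable (G □ K k t) (c′ + k) → DPColorable G c′
DPColorable-□K⁻ {G} {k} {t} {c′} 𝓗₀ q^k≤t D 𝓑 =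
  choice⇒HasColoring 𝓑 (B-color-col 𝓑 q^k≤t (proj₂ coloring))
  where
  open LowerBound {G} {k} {t} {c′} 𝓗₀
  coloring : ∃ (IsChoiceColoring (cover 𝓑))
  coloring = HasColoring⇒choice (cover 𝓑) (D (cover 𝓑))

theorem4 : (G : Graph) → 0 < n G → (k t : ℕ) →
    (c : ℕ) → IsChiDP G c →
    (p : ℕ) → IsPDP G (c + k ∸ 1) p →
    p ^ k ≤ t →
    IsChiDP (G □ K k t) (c + k)
theorem4 G 0<n k t zero (G-col , _) p _ p^k≤t = ⊥-elim (¬DPColorable-zero G 0<n G-col)
theorem4 G 0<n k t (suc c′) (G-col , minimal) p ((𝓗₀ , refl) , _) p^k≤t =
  DPColorable-□K G k t (suc c′) G-col ,
  λ { m (s≤s m≤c′+k) D →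
        minimal c′ (n<1+n c′) (DPColorable-□K⁻ 𝓗₀ p^k≤t (DPColorable-mono _ m≤c′+k D)) }
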